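{- Let $G=(V,E)$ be a finite simple graph and let $X,X'\in\{\mathrm{ID},\mathrm{ITD},\mathrm{LD},\mathrm{LTD},\mathrm{FD},\mathrm{FTD},\mathrm{OD},\mathrm{OTD}\}$. Suppose the hyperedge families $\mathcal{F}_X$ and $\mathcal{F}_{X'}$ of the X-hypergraphs $\mathcal{H}_X(G)=(V,\mathcal{F}_X)$ and $\mathcal{H}_{X'}(G)=(V,\mathcal{F}_{X'})$ differ only in exactly one of the following ways (all other constituent families being the same): (a) $\mathcal{F}_X$ contains $N(G)$ where $\mathcal{F}_{X'}$ contains $N[G]$; or (b) $\mathcal{F}_X$ contains $\bigtriangleup_a[G]$ where $\mathcal{F}_{X'}$ contains $\bigtriangleup_a(G)$; or (c) $\mathcal{F}_X$ contains $\bigtriangleup_n(G)$ where $\mathcal{F}_{X'}$ contains $\bigtriangleup_n[G]$. Then $\mathcal{H}_X(G)\prec\mathcal{H}_{X'}(G)$, and in particular $\gamma^{X'}(G)\le\gamma^{X}(G)$ (with the convention that $\gamma^{Y}(G)=+\infty$ if $G$ has no Y-code).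
   Context: For a vertex $v$, $N(v)$ and $N[v]=N(v)\cup\{v\}$ are its open and closed neighborhoods; $\bigtriangleup$ is symmetric difference. Define: $N[G]=\{N[v]:v\in V\}$, $N(G)=\{N(v):v\in V\}$; $\bigtriangleup_a[G]$ (resp. $\bigtriangleup_a(G)$) is the set of $N[u]\bigtriangleup N[v]$ (resp. $N(u)\bigtriangleup N(v)$) over all adjacent pairs $u,v$; $\bigtriangleup_n[G]$ (resp. $\bigtriangleup_n(G)$) is the set of $N[u]\bigtriangleup N[v]$ (resp. $N(u)\bigtriangleup N(v)$) over all distinct non-adjacent pairs $u,v$. The X-hypergraph is $\mathcal{H}_X(G)=(V,\mathcal{F}_X)$ with $\mathcal{F}_X$ the union of three families: ID: $N[G],\bigtriangleup_a[G],\bigtriangleup_n[G]$; ITD: $N(G),\bigtriangleup_a[G],\bigtriangleup_n[G]$; LD: $N[G],\bigtriangleup_a(G),\bigtriangleup_n[G]$; LTD: $N(G),\bigtriangleup_a(G),\bigtriangleup_n[G]$; FD: $N[G],\bigtriangleup_a[G],\bigtriangleup_n(G)$; FTD: $N(G),\bigtriangleup_a[G],\bigtriangleup_n(G)$; OD: $N[G],\bigtriangleup_a(G),\bigtriangleup_n(G)$; OTD: $N(G),\bigtriangleup_a(G),\bigtriangleup_n(G)$. An X-code of $G$ is a set $C\subseteq V$ meeting every hyperedge of $\mathcal{H}_X(G)$, and $\gamma^X(G)$ is the minimum size of an X-code. For hypergraphs on the same vertex set, $\mathcal{H}\prec\mathcal{H}'$ means every hyperedge of $\mathcal{H}'$ contains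 some hyperedge of $\mathcal{H}$. -}

module Defs where

open import Data.Bool using (Bool; true; false; _∨_; _xor_)
open import Data.Nat using (ℕ; _≤_)
open import Data.Fin using (Fin; _≟_)
open import Data.Fin.Subset using (Subset; _∈_; _⊆_; ∣_∣)
open import Data.Vec using (tabulate; zipWith)
open import Data.Product using (Σ; ∃; ∃-syntax; _×_)
open import Data.Sum using (_⊎_)
open import Relation.Nullary using (¬_; ⌊_⌋)
open import Relation.Binary.PropositionalEquality using (_≡_; _≢_)

record Graph (n : ℕ) : Set where
  field
    E     : Fin n → Fin n → Bool
    sym   : ∀ u v → E u v ≡ E v u
    irref : ∀ v → E v v ≡ false

module _ {n : ℕ} (G : Graph n) where
  open Graph G

  Adj : Fin n → Fin n → Set
  Adj u v = E u v ≡ true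

  Nopen : Fin n → Subset n
  Nopen v = tabulate (λ u → E v u)

  Nclosed : Fin n → Subset n
  Nclosed v = tabulate (λ u → E v u ∨ ⌊ u ≟ v ⌋)

_△_ : ∀ {n} → Subset n → Subset n → Subset n
p △ q = zipWith _xor_ p q

data Kind : Set where
  open′ closed′ : Kind

Nbhd : ∀ {n} → Graph n → Kind → Fin n → Subset n
Nbhd G open′   = Nopen G
Nbhd G closed′ = Nclosed G

data CodeType : Set where
  ID ITD LD LTD FD FTD OD OTD : CodeType

-- the three constituents of F_X:
--   kindN  : N[G] (closed) or N(G) (open)
--   kindA  : △_a[G] (closed) or △_a(G) (open)
--   kindNA : △_n[G] (closed) or △_n(G) (open)
kindN kindA kindNA : CodeType → Kind
kindN ID  = closed′
kindN ITD = open′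
kindN LD  = closed′
kindN LTD = open′
kindN FD  = closed′
kindN FTD = open′
kindN OD  = closed′
kindN OTD = open′
kindA ID  = closed′
kindA ITD = closed′
kindA LD  = open′
kindA LTD = open′
kindA FD  = closed′
kindA FTD = closed′
kindA OD  = open′
kindA OTD = open′
kindNA ID  = closed′
kindNA ITD = closed′
kindNA LD  = closed′
kindNA LTD = closed′
kindNA FD  = open′
kindNA FTD = open′
kindNA OD  = open′
kindNA OTD = open′

Hyperedge : ∀ {n} → CodeType → Graph n → Subset n → Set
Hyperedge X G e =
    (∃[ v ] e ≡ Nbhd G (kindN X) v)
  ⊎ (∃[ u ] ∃[ v ] (Adj G u v × e ≡ (Nbhd G (kindA X) u △ Nbhd G (kindA X) v)))
  ⊎ (∃[ u ] ∃[ v ] (u ≢ v × ¬ Adj G u v × e ≡ (Nbhd G (kindNA X) u △ Nbhd G (kindNA X) v)))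

_≺_ : ∀ {n} → (Subset n → Set) → (Subset n → Set) → Set
H ≺ H' = ∀ e′ → H' e′ → ∃[ e ] (H e × e ⊆ e′)

IsCode : ∀ {n} → CodeType → Graph n → Subset n → Set
IsCode X G C = ∀ e → Hyperedge X G e → ∃[ v ] (v ∈ C × v ∈ e)

-- γ^X'(G) ≤ γ^X(G) in ℕ ∪ {+∞} (γ = +∞ when no code exists):
-- every size attained by an X-code is bounded below by the size of some X'-code.
γ≤γ : ∀ {n} → CodeType → CodeType → Graph n → Set
γ≤γ X' X G = ∀ C → IsCode X G C → ∃[ C′ ] (IsCode X' G C′ × ∣ C′ ∣ ≤ ∣ C ∣)

DiffersAsInCor3 : CodeType → CodeType → Set
DiffersAsInCor3 X X' =
    (kindN X ≡ open′ × kindN X' ≡ closed′ × kindA X ≡ kindA X' × kindNA X ≡ kindNA X')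
  ⊎ (kindA X ≡ closed′ × kindA X' ≡ open′ × kindN X ≡ kindN X' × kindNA X ≡ kindNA X')
  ⊎ (kindNA X ≡ open′ × kindNA X' ≡ closed′ × kindN X ≡ kindN X' × kindA X ≡ kindA X')

-- Passing from X to X' replaces one constituent family by another in
-- which every hyperedge contains a hyperedge of the old family:
-- N(v) ⊆ N[v]; for adjacent u, v the sets N[u] △ N[v] and N(u) △ N(v)
-- agree outside {u, v}, where the former misses both u and v; and for
-- distinct non-adjacent u, v the latter misses both u and v.  Hence
-- H_X(G) ≺ H_X'(G), and a set meeting every hyperedge of H_X(G) meets
-- every hyperedge of H_X'(G), so every X-code is an X'-code.
module Submission where

open import Defs
open import Data.Bool using (true; not; _∨_; _xor_)
open import Data.Bool.Properties using (∨-identityʳ; ∨-zeroʳ; xor-comm; not-¬)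
open import Data.Empty using (⊥-elim)
open import Data.Fin using (_≟_)
open import Data.Fin.Subset using (Subset; _∈_; _⊆_)
open import Data.Nat using (ℕ)
open import Data.Nat.Properties using (≤-refl)
open import Data.Product using (_×_; _,_; ∃-syntax; map₁; map₂)
open import Data.Sum using (_⊎_; inj₁; inj₂)
open import Data.Vec using (lookup)
open import Data.Vec.Properties using ([]=⇒lookup; lookup⇒[]=; lookup-zipWith; lookup∘tabulate)
open import Function using (id)
open import Relation.Nullary using (¬_; yes; no; ⌊_⌋; contradiction)
open import Relation.Binary.PropositionalEquality
  using (_≡_; _≢_; refl; sym; trans; cong; cong₂; ≢-sym; module ≡-Reasoning)

module _ {n : ℕ} where

  _∪_ : (Subset n → Set) → (Subset n → Set) → Subset n → Set
  (H ∪ H′) e = H e ⊎ H′ e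

  Transversal : (Subset n → Set) → Subset n → Set
  Transversal H C = ∀ e → H e → ∃[ v ] (v ∈ C × v ∈ e)

  ≺-refl : ∀ {H : Subset n → Set} → H ≺ H
  ≺-refl e h = e , h , id

  ∪-mono-≺ : ∀ {H₁ H₁′ H₂ H₂′ : Subset n → Set} → H₁ ≺ H₁′ → H₂ ≺ H₂′ → (H₁ ∪ H₂) ≺ (H₁′ ∪ H₂′)
  ∪-mono-≺ H₁≺H₁′ H₂≺H₂′ e (inj₁ h) = map₂ (map₁ inj₁) (H₁≺H₁′ e h)
  ∪-mono-≺ H₁≺H₁′ H₂≺H₂′ e (inj₂ h) = map₂ (map₁ inj₂) (H₂≺H₂′ e h)

  ≺-transversal : ∀ {H H′ : Subset n → Set} {C} → H ≺ H′ → Transversal H C → Transversal H′ C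
  ≺-transversal H≺H′ T e′ h′ with H≺H′ e′ h′
  ... | e , h , e⊆e′ = map₂ (map₂ e⊆e′) (T e h)

  ⊆-lookup : ∀ {p q : Subset n} → (∀ w → lookup p w ≡ true → lookup q w ≡ true) → p ⊆ q
  ⊆-lookup {p} {q} p⇒q {w} w∈p = lookup⇒[]= w q (p⇒q w ([]=⇒lookup w∈p))

  lookup-△ : ∀ (p q : Subset n) w → lookup (p △ q) w ≡ lookup p w xor lookup q w
  lookup-△ p q w = lookup-zipWith _xor_ w p q

  lookup-△-comm : ∀ (p q : Subset n) w → lookup (p △ q) w ≡ lookup (q △ p) w
  lookup-△-comm p q w = begin
    lookup (p △ q) w            ≡⟨ lookup-△ p q w ⟩
    lookup p w xor lookup q w   ≡⟨ xor-comm (lookup p w) (lookup q w) ⟩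
    lookup q w xor lookup p w   ≡⟨ lookup-△ q p w ⟨
    lookup (q △ p) w            ∎
    where open ≡-Reasoning

module _ {n : ℕ} (G : Graph n) where
  open Graph G renaming (sym to E-sym)

  adjacent-distinct : ∀ {u v} → Adj G u v → u ≢ v
  adjacent-distinct {u} adj refl with trans (sym adj) (irref u)
  ... | ()

  lookup-Nopen : ∀ v w → lookup (Nopen G v) w ≡ E v w
  lookup-Nopen v w = lookup∘tabulate (E v) w

  lookup-Nclosed-self : ∀ v → lookup (Nclosed G v) v ≡ true
  lookup-Nclosed-self v rewrite lookup∘tabulate (λ w → E v w ∨ ⌊ w ≟ v ⌋) v with v ≟ v
  ... | yes _   = ∨-zeroʳ (E v v)
  ... | no v≢v = contradiction refl v≢v

  lookup-Nclosed-off : ∀ {v w} → w ≢ v → lookup (Nclosed G v) w ≡ E v w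
  lookup-Nclosed-off {v} {w} w≢v rewrite lookup∘tabulate (λ w → E v w ∨ ⌊ w ≟ v ⌋) w with w ≟ v
  ... | yes w≡v = contradiction w≡v w≢v
  ... | no _    = ∨-identityʳ (E v w)

  Nopen⊆Nclosed : ∀ v → Nopen G v ⊆ Nclosed G v
  Nopen⊆Nclosed v = ⊆-lookup λ w w∈N⟨v⟩ →
    let adj = trans (sym (lookup-Nopen v w)) w∈N⟨v⟩
    in trans (lookup-Nclosed-off (≢-sym (adjacent-distinct adj))) adj

  △-closed≡△-open-off : ∀ {u v w} → w ≢ u → w ≢ v →
    lookup (Nclosed G u △ Nclosed G v) w ≡ lookup (Nopen G u △ Nopen G v) w
  △-closed≡△-open-off {u} {v} {w} w≢u w≢v = begin
    lookup (Nclosed G u △ Nclosed G v) w                 ≡⟨ lookup-△ (Nclosed G u) (Nclosed G v) w ⟩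
    lookup (Nclosed G u) w xor lookup (Nclosed G v) w   ≡⟨ cong₂ _xor_ (lookup-Nclosed-off w≢u) (lookup-Nclosed-off w≢v) ⟩
    E u w xor E v w                                     ≡⟨ cong₂ _xor_ (lookup-Nopen u w) (lookup-Nopen v w) ⟨
    lookup (Nopen G u) w xor lookup (Nopen G v) w       ≡⟨ lookup-△ (Nopen G u) (Nopen G v) w ⟨
    lookup (Nopen G u △ Nopen G v) w                     ∎
    where open ≡-Reasoning

  lookup-△-open-left : ∀ u v → lookup (Nopen G u △ Nopen G v) u ≡ E u v
  lookup-△-open-left u v = begin
    lookup (Nopen G u △ Nopen G v) u                 ≡⟨ lookup-△ (Nopen G u) (Nopen G v) u ⟩
    lookup (Nopen G u) u xor lookup (Nopen G v) u   ≡⟨ cong₂ _xor_ (trans (lookup-Nopen u u) (irref u)) (lookup-Nopen v u) ⟩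
    E v u                                           ≡⟨ E-sym v u ⟩
    E u v                                           ∎
    where open ≡-Reasoning

  lookup-△-open-right : ∀ u v → lookup (Nopen G u △ Nopen G v) v ≡ E u v
  lookup-△-open-right u v =
    trans (lookup-△-comm (Nopen G u) (Nopen G v) v) (trans (lookup-△-open-left v u) (E-sym v u))

  lookup-△-closed-left : ∀ {u v} → u ≢ v → lookup (Nclosed G u △ Nclosed G v) u ≡ not (E u v)
  lookup-△-closed-left {u} {v} u≢v = begin
    lookup (Nclosed G u △ Nclosed G v) u                 ≡⟨ lookup-△ (Nclosed G u) (Nclosed G v) u ⟩
    lookup (Nclosed G u) u xor lookup (Nclosed G v) u   ≡⟨ cong₂ _xor_ (lookup-Nclosed-self u) (lookup-Nclosed-off u≢v) ⟩
    not (E v u)                                         ≡⟨ cong not (E-sym v u) ⟩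
    not (E u v)                                         ∎
    where open ≡-Reasoning

  lookup-△-closed-right : ∀ {u v} → u ≢ v → lookup (Nclosed G u △ Nclosed G v) v ≡ not (E u v)
  lookup-△-closed-right {u} {v} u≢v =
    trans (lookup-△-comm (Nclosed G u) (Nclosed G v) v)
          (trans (lookup-△-closed-left (≢-sym u≢v)) (cong not (E-sym v u)))

  adjacent-△-closed⊆△-open : ∀ {u v} → Adj G u v →
    (Nclosed G u △ Nclosed G v) ⊆ (Nopen G u △ Nopen G v)
  adjacent-△-closed⊆△-open {u} {v} adj = ⊆-lookup go
    where
    u≢v : u ≢ v
    u≢v = adjacent-distinct adj
    go : ∀ w → lookup (Nclosed G u △ Nclosed G v) w ≡ true → lookup (Nopen G u △ Nopen G v) w ≡ true
    go w w∈△ with w ≟ u | w ≟ v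
    ... | yes refl | _      = ⊥-elim (not-¬ (sym adj) (trans (sym w∈△) (lookup-△-closed-left u≢v)))
    ... | _ | yes refl      = ⊥-elim (not-¬ (sym adj) (trans (sym w∈△) (lookup-△-closed-right u≢v)))
    ... | no w≢u | no w≢v = trans (sym (△-closed≡△-open-off w≢u w≢v)) w∈△

  nonadjacent-△-open⊆△-closed : ∀ {u v} → u ≢ v → ¬ Adj G u v →
    (Nopen G u △ Nopen G v) ⊆ (Nclosed G u △ Nclosed G v)
  nonadjacent-△-open⊆△-closed {u} {v} u≢v ¬adj = ⊆-lookup go
    where
    go : ∀ w → lookup (Nopen G u △ Nopen G v) w ≡ true → lookup (Nclosed G u △ Nclosed G v) w ≡ true
    go w w∈△ with w ≟ u | w ≟ v
    ... | yes refl | _      = ⊥-elim (¬adj (trans (sym (lookup-△-open-left u v)) w∈△))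
    ... | _ | yes refl      = ⊥-elim (¬adj (trans (sym (lookup-△-open-right u v)) w∈△))
    ... | no w≢u | no w≢v = trans (△-closed≡△-open-off w≢u w≢v) w∈△

  Neighbourhoods : Kind → Subset n → Set
  Neighbourhoods k e = ∃[ v ] e ≡ Nbhd G k v

  AdjacentDifferences : Kind → Subset n → Set
  AdjacentDifferences k e = ∃[ u ] ∃[ v ] (Adj G u v × e ≡ (Nbhd G k u △ Nbhd G k v))

  NonAdjacentDifferences : Kind → Subset n → Set
  NonAdjacentDifferences k e =
    ∃[ u ] ∃[ v ] (u ≢ v × ¬ Adj G u v × e ≡ (Nbhd G k u △ Nbhd G k v))

  Neighbourhoods-≺ : Neighbourhoods open′ ≺ Neighbourhoods closed′
  Neighbourhoods-≺ _ (v , refl) = Nopen G v , (v , refl) , Nopen⊆Nclosed v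

  AdjacentDifferences-≺ : AdjacentDifferences closed′ ≺ AdjacentDifferences open′
  AdjacentDifferences-≺ _ (u , v , adj , refl) =
    Nclosed G u △ Nclosed G v , (u , v , adj , refl) , adjacent-△-closed⊆△-open adj

  NonAdjacentDifferences-≺ : NonAdjacentDifferences open′ ≺ NonAdjacentDifferences closed′
  NonAdjacentDifferences-≺ _ (u , v , u≢v , ¬adj , refl) =
    Nopen G u △ Nopen G v , (u , v , u≢v , ¬adj , refl) , nonadjacent-△-open⊆△-closed u≢v ¬adj

-- Hyperedge X G unfolds to Neighbourhoods ∪ (AdjacentDifferences ∪ NonAdjacentDifferences).
Hyperedge-≺ : ∀ {n} (G : Graph n) (X X' : CodeType) →
  DiffersAsInCor3 X X' → Hyperedge X G ≺ Hyperedge X' G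
Hyperedge-≺ G X X' (inj₁ (nX , nX' , a≡ , na≡)) rewrite nX | nX' | a≡ | na≡ =
  ∪-mono-≺ (Neighbourhoods-≺ G) (∪-mono-≺ ≺-refl ≺-refl)
Hyperedge-≺ G X X' (inj₂ (inj₁ (aX , aX' , n≡ , na≡))) rewrite aX | aX' | n≡ | na≡ =
  ∪-mono-≺ ≺-refl (∪-mono-≺ (AdjacentDifferences-≺ G) ≺-refl)
Hyperedge-≺ G X X' (inj₂ (inj₂ (naX , naX' , n≡ , a≡))) rewrite naX | naX' | n≡ | a≡ =
  ∪-mono-≺ ≺-refl (∪-mono-≺ ≺-refl (NonAdjacentDifferences-≺ G))

≺⇒γ≤γ : ∀ {n} (G : Graph n) (X X' : CodeType) → Hyperedge X G ≺ Hyperedge X' G → γ≤γ X' X G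
≺⇒γ≤γ G X X' H≺H′ C C-code = C , ≺-transversal H≺H′ C-code , ≤-refl

corollary3 : ∀ {n} (G : Graph n) (X X' : CodeType) →
    DiffersAsInCor3 X X' →
    (Hyperedge X G ≺ Hyperedge X' G) × γ≤γ X' X G
corollary3 G X X' d = H≺H′ , ≺⇒γ≤γ G X X' H≺H′
  where
  H≺H′ : Hyperedge X G ≺ Hyperedge X' G
  H≺H′ = Hyperedge-≺ G X X' d
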